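{- Let $(a_n)_{n\in\mathbf{N}}$ be a sequence in $\mathcal{C}$, let $s\ge1$, and suppose the prefix $w_a(0,s)$ has an optimal palindromic decomposition $w_a(0,s)=p_1p_2\cdots p_r$ such that every $p_i$ (viewed as the factor occurrence at its position in $w_a(0,s)$) is either a single letter or can be embedded into the center of a palindromic factor of the form $w_a(4z,4t)$ ($z,t\in\mathbf{N}$). Then $w_a(0,s)$ has at least one optimal palindromic decomposition of one of the following forms: (i) $q_1q_2\cdots q_r$, and then $s\equiv0\pmod 4$; (ii) $q_1q_2\cdots q_{r-1}t_1$, and then $s\equiv1\pmod 4$; (iii) $q_1q_2\cdots q_{r-2}t_1t_2$, and then $s\equiv2\pmod 4$; (iv) $q_1q_2\cdots q_{r-2}t_1l_1$, and then $s\equiv3\pmod 4$; (v) $q_1q_2\cdots q_{r-3}t_1t_2l_1$, and then $s\equiv2\pmod 4$; where each $q_i$ is a palindrome whose length is a positive multiple of $4$, each $t_i$ is a single letter, and $l_1$ is a palindrome of even length.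
   Context: $w_a(x,y)=a_x\cdots a_{x+y-1}$. A word is a palindrome if it equals its reversal. An optimal palindromic decomposition of a word $w$ is a factorization $w=p_1\cdots p_k$ into palindromes with $k$ minimal (this minimal $k$ is the palindromic length of $w$). A factor $w_a(x,y)$ is embedded into the center of $w_a(X,Y)$ if $X\le x$, $x+y\le X+Y$ and $x-X=(X+Y)-(x+y)$. The class $\mathcal{C}$: let $\Sigma$ be an alphabet with at least two letters and $a\in\Sigma$. For a bijection $g$ of $\Sigma$ and a word $u$, $g(u)$ is the letter-by-letter image. Let $(f_n)_{n\ge0}$ be bijections of $\Sigma$ and define $w_0=a$, $w_n=w_{n-1}f_{n-1}(w_{n-1})f_{n-1}(w_{n-1})w_{n-1}$ for $n>0$, with the requirement $f_n(w_n)\neq w_n$ for all $n\ge0$. The limit infinite sequence is in $\mathcal{C}$; $\mathcal{C}$ is the set of all such limits. -}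

module Defs where

open import Data.Nat using (ℕ; zero; suc; _+_; _*_; _∸_; _≤_; _%_)
open import Data.Fin using (Fin)
open import Data.Fin.Permutation using (Permutation′; _⟨$⟩ʳ_)
open import Data.List using (List; []; _∷_; _++_; map; reverse; length; concat; upTo)
open import Data.List.Relation.Unary.All using (All)
open import Data.Product using (Σ; ∃; ∃-syntax; _×_; _,_)
open import Data.Sum using (_⊎_)
open import Relation.Binary.PropositionalEquality using (_≡_; _≢_)

-- w_a(x,y) = a_x ⋯ a_{x+y-1}
factor : {k : ℕ} → (ℕ → Fin k) → ℕ → ℕ → List (Fin k)
factor a x y = map (λ i → a (x + i)) (upTo y)

Palindrome : {A : Set} → List A → Set
Palindrome w = w ≡ reverse w

IsPalDecomp : {A : Set} → List A → List (List A) → Set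
IsPalDecomp w ps = (concat ps ≡ w) × All (λ p → Palindrome p × (p ≢ [])) ps

IsOptimalPalDecomp : {A : Set} → List A → List (List A) → Set
IsOptimalPalDecomp w ps =
  IsPalDecomp w ps × (∀ qs → IsPalDecomp w qs → length ps ≤ length qs)

EmbeddedCenter : ℕ → ℕ → ℕ → ℕ → Set
EmbeddedCenter x y X Y = (X ≤ x) × (x + y ≤ X + Y) × (x ∸ X ≡ (X + Y) ∸ (x + y))

occurrences : {A : Set} → ℕ → List (List A) → List (ℕ × List A)
occurrences pos [] = []
occurrences pos (p ∷ ps) = (pos , p) ∷ occurrences (pos + length p) ps

applyPerm : {k : ℕ} → Permutation′ k → List (Fin k) → List (Fin k)
applyPerm g = map (g ⟨$⟩ʳ_)

wSeq : {k : ℕ} → Fin k → (ℕ → Permutation′ k) → ℕ → List (Fin k)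
wSeq c f zero = c ∷ []
wSeq c f (suc n) = let w = wSeq c f n ; v = applyPerm (f n) w in w ++ v ++ v ++ w

-- the class 𝒞 (over alphabet Fin k): a is the limit of some sequence (w_n)
-- i.e. every w_n is a prefix of a
InC : {k : ℕ} → (ℕ → Fin k) → Set
InC {k} a = Σ (Fin k) λ c → Σ (ℕ → Permutation′ k) λ f →
  (∀ n → applyPerm (f n) (wSeq c f n) ≢ wSeq c f n) ×
  (∀ n → factor a 0 (length (wSeq c f n)) ≡ wSeq c f n)

GoodOccurrence : {k : ℕ} → (ℕ → Fin k) → ℕ × List (Fin k) → Set
GoodOccurrence a (x , p) =
  (length p ≡ 1) ⊎
  (∃[ z ] ∃[ t ] Palindrome (factor a (4 * z) (4 * t)) × EmbeddedCenter x (length p) (4 * z) (4 * t))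

PosMult4 : {A : Set} → List A → Set
PosMult4 q = ∃[ m ] length q ≡ 4 * suc m

Letter : {A : Set} → List A → Set
Letter t = length t ≡ 1

EvenLen : {A : Set} → List A → Set
EvenLen l = ∃[ m ] length l ≡ 2 * m

Forms : {A : Set} → ℕ → ℕ → List (List A) → Set
Forms r s ds =
  (∃[ qs ] ds ≡ qs × All PosMult4 qs × length qs ≡ r × s % 4 ≡ 0)
  ⊎ (∃[ qs ] ∃[ t₁ ] ds ≡ qs ++ t₁ ∷ [] × All PosMult4 qs × length qs ≡ r ∸ 1
       × Letter t₁ × s % 4 ≡ 1)
  ⊎ (∃[ qs ] ∃[ t₁ ] ∃[ t₂ ] ds ≡ qs ++ t₁ ∷ t₂ ∷ [] × All PosMult4 qs × length qs ≡ r ∸ 2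
       × Letter t₁ × Letter t₂ × s % 4 ≡ 2)
  ⊎ (∃[ qs ] ∃[ t₁ ] ∃[ l₁ ] ds ≡ qs ++ t₁ ∷ l₁ ∷ [] × All PosMult4 qs × length qs ≡ r ∸ 2
       × Letter t₁ × EvenLen l₁ × s % 4 ≡ 3)
  ⊎ (∃[ qs ] ∃[ t₁ ] ∃[ t₂ ] ∃[ l₁ ] ds ≡ qs ++ t₁ ∷ t₂ ∷ l₁ ∷ [] × All PosMult4 qs
       × length qs ≡ r ∸ 3 × Letter t₁ × Letter t₂ × EvenLen l₁ × s % 4 ≡ 2)

module Submission where

-- Each w_n with n ≥ 1 is a concatenation of blocks xyyx, so every aligned block
-- w_a(4n,4) is a palindrome.  A factor centred in a palindrome w_a(4z,4t) and
-- starting at 4N + r (0 ≤ r < 4) widens, by r letters on each side, to an aligned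
-- palindrome w_a(4N,4u).  Reading the given decomposition from left to right we
-- therefore maintain a decomposition of the prefix read so far into aligned
-- palindromes of length 4m followed by one of the tails ε, t, t t, t l, t t l,
-- never using more factors than were read.  At the end optimality makes the two
-- counts equal, and the tail determines the form and s mod 4.

open import Defs
open import Data.Nat using (ℕ; zero; suc; _+_; _*_; _∸_; _≤_; _<_; z≤n; s≤s; s≤s⁻¹; _%_)
open import Data.Nat.Properties
open import Data.Nat.DivMod using ([m+kn]%n≡m%n)
open import Data.Fin using (Fin)
open import Data.Fin.Permutation using (Permutation′; _⟨$⟩ʳ_)
open import Data.List using (List; []; _∷_; _++_; map; reverse; length; concat; upTo; applyUpTo)
open import Data.List.Properties
  using (∷-injectiveˡ; ∷-injectiveʳ; ++-assoc; ++-identityʳ; concat-++; reverse-++; map-cong; map-upTo;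
         map-applyUpTo; length-++; length-++-≤ʳ; length-map; length-reverse; length-upTo)
open import Data.List.Relation.Unary.All as All using (All; []; _∷_)
open import Data.List.Relation.Unary.All.Properties using (++⁺)
open import Data.Product using (∃-syntax; _×_; _,_; proj₁; proj₂)
open import Data.Sum using (_⊎_; inj₁; inj₂)
open import Data.Empty using (⊥-elim)
open import Relation.Binary.PropositionalEquality
open import Function using (_∘_)
open import Data.Nat.Tactic.RingSolver using (solve-∀)

module _ {A : Set} where

  ++-injective : (xs ys : List A) {us vs : List A} → length xs ≡ length ys →
                 xs ++ us ≡ ys ++ vs → xs ≡ ys × us ≡ vs
  ++-injective []       []       _   eq = refl , eq
  ++-injective (x ∷ xs) (y ∷ ys) len eq
    with xs≡ys , us≡vs ← ++-injective xs ys (suc-injective len) (∷-injectiveʳ eq) =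
    cong₂ _∷_ (∷-injectiveˡ eq) xs≡ys , us≡vs

  palindrome-infix : (u v w : List A) → length u ≡ length w →
                     Palindrome (u ++ v ++ w) → Palindrome v
  palindrome-infix u v w len pal =
    proj₁ (++-injective v (reverse v) (sym (length-reverse v))
                        (proj₂ (++-injective u (reverse w) len′ pal′)))
    where
    len′ : length u ≡ length (reverse w)
    len′ = trans len (sym (length-reverse w))
    pal′ : u ++ v ++ w ≡ reverse w ++ reverse v ++ reverse u
    pal′ = begin
      u ++ v ++ w                           ≡⟨ pal ⟩
      reverse (u ++ v ++ w)                 ≡⟨ reverse-++ u (v ++ w) ⟩
      reverse (v ++ w) ++ reverse u         ≡⟨ cong (_++ reverse u) (reverse-++ v w) ⟩
      (reverse w ++ reverse v) ++ reverse u ≡⟨ ++-assoc (reverse w) (reverse v) (reverse u) ⟩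
      reverse w ++ reverse v ++ reverse u   ∎
      where open ≡-Reasoning

module _ {k : ℕ} (a : ℕ → Fin k) where

  factor-suc : ∀ x y → factor a x (suc y) ≡ a x ∷ factor a (suc x) y
  factor-suc x y = cong₂ _∷_ (cong a (+-identityʳ x)) (begin
    map (λ i → a (x + i)) (applyUpTo suc y) ≡⟨ map-applyUpTo suc (λ i → a (x + i)) y ⟩
    applyUpTo (λ i → a (x + suc i)) y        ≡⟨ map-upTo (λ i → a (x + suc i)) y ⟨
    map (λ i → a (x + suc i)) (upTo y)       ≡⟨ map-cong (λ i → cong a (+-suc x i)) (upTo y) ⟩
    factor a (suc x) y                       ∎)
    where open ≡-Reasoning

  length-factor : ∀ x y → length (factor a x y) ≡ y
  length-factor x y = trans (length-map (λ i → a (x + i)) (upTo y)) (length-upTo y)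

  factor-++ : ∀ x y z → factor a x (y + z) ≡ factor a x y ++ factor a (x + y) z
  factor-++ x zero    z = cong (λ x′ → factor a x′ z) (sym (+-identityʳ x))
  factor-++ x (suc y) z = begin
    factor a x (suc (y + z))                      ≡⟨ factor-suc x (y + z) ⟩
    a x ∷ factor a (suc x) (y + z)                ≡⟨ cong (a x ∷_) (factor-++ (suc x) y z) ⟩
    a x ∷ factor a (suc x) y ++ factor a (suc x + y) z
      ≡⟨ cong₂ (λ w x′ → w ++ factor a x′ z) (sym (factor-suc x y)) (sym (+-suc x y)) ⟩
    factor a x (suc y) ++ factor a (x + suc y) z  ∎
    where open ≡-Reasoning

  palindrome-center : ∀ x d y → Palindrome (factor a x (d + y + d)) → Palindrome (factor a (d + x) y)
  palindrome-center x d y pal = subst (λ x′ → Palindrome (factor a x′ y)) (+-comm x d)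
    (palindrome-infix (factor a x d) (factor a (x + d) y) (factor a (x + d + y) d)
      (trans (length-factor x d) (sym (length-factor (x + d + y) d)))
      (subst Palindrome split pal))
    where
    split : factor a x (d + y + d) ≡ factor a x d ++ factor a (x + d) y ++ factor a (x + d + y) d
    split = begin
      factor a x (d + y + d)                                         ≡⟨ factor-++ x (d + y) d ⟩
      factor a x (d + y) ++ factor a (x + (d + y)) d
        ≡⟨ cong₂ (λ w x′ → w ++ factor a x′ d) (factor-++ x d y) (sym (+-assoc x d y)) ⟩
      (factor a x d ++ factor a (x + d) y) ++ factor a (x + d + y) d ≡⟨ ++-assoc (factor a x d) _ _ ⟩
      factor a x d ++ factor a (x + d) y ++ factor a (x + d + y) d   ∎
      where open ≡-Reasoning

EmbeddedCenter⇒margin : ∀ {x y X Y} → EmbeddedCenter x y X Y → ∃[ d ] x ≡ X + d × Y ≡ d + y + d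
EmbeddedCenter⇒margin {x} {y} {X} {Y} (X≤x , end≤ , margins) =
  d , sym (m+[n∸m]≡n X≤x) , +-cancelˡ-≡ X Y (d + y + d) (begin
    X + Y                       ≡⟨ m+[n∸m]≡n end≤ ⟨
    x + y + (X + Y ∸ (x + y))
      ≡⟨ cong₂ (λ x′ d′ → x′ + y + d′) (sym (m+[n∸m]≡n X≤x)) (sym margins) ⟩
    X + d + y + d               ≡⟨ cong (_+ d) (+-assoc X d y) ⟩
    X + (d + y) + d             ≡⟨ +-assoc X (d + y) d ⟩
    X + (d + y + d)             ∎)
  where
  open ≡-Reasoning
  d = x ∸ X

4z≤4N+r⇒z≤N : ∀ {z N r} → 4 * z ≤ 4 * N + r → r < 4 → z ≤ N
4z≤4N+r⇒z≤N {z} {N} {r} 4z≤ r<4 = s≤s⁻¹ (*-cancelˡ-< 4 z (suc N) (begin-strict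
  4 * z       ≤⟨ 4z≤ ⟩
  4 * N + r   <⟨ +-monoʳ-< (4 * N) r<4 ⟩
  4 * N + 4   ≡⟨ +-comm (4 * N) 4 ⟩
  4 + 4 * N   ≡⟨ *-suc 4 N ⟨
  4 * suc N   ∎))
  where open ≤-Reasoning

offset-decomposition : ∀ {z d N r} → 4 * z + d ≡ 4 * N + r → r < 4 →
                       ∃[ q ] z + q ≡ N × d ≡ 4 * q + r
offset-decomposition {z} {d} {N} {r} eq r<4
  with q , z+q≡N ← m≤n⇒∃[o]m+o≡n (4z≤4N+r⇒z≤N (subst (4 * z ≤_) eq (m≤m+n (4 * z) d)) r<4) =
  q , z+q≡N , +-cancelˡ-≡ (4 * z) d (4 * q + r) (begin
    4 * z + d             ≡⟨ eq ⟩
    4 * N + r             ≡⟨ cong (λ n → 4 * n + r) z+q≡N ⟨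
    4 * (z + q) + r       ≡⟨ cong (_+ r) (*-distribˡ-+ 4 z q) ⟩
    4 * z + 4 * q + r     ≡⟨ +-assoc (4 * z) (4 * q) r ⟩
    4 * z + (4 * q + r)   ∎)
  where open ≡-Reasoning

window-quotient : ∀ t q {M} → 4 * t ≡ 4 * q + M + 4 * q → M ≡ 4 * (t ∸ 2 * q)
window-quotient t q {M} 4t≡ = sym (begin
  4 * (t ∸ 2 * q)               ≡⟨ *-distribˡ-∸ 4 t (2 * q) ⟩
  4 * t ∸ 4 * (2 * q)           ≡⟨ cong (_∸ 4 * (2 * q)) (trans 4t≡ (double q M)) ⟩
  4 * (2 * q) + M ∸ 4 * (2 * q) ≡⟨ m+n∸m≡n (4 * (2 * q)) M ⟩
  M                             ∎)
  where
  open ≡-Reasoning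
  double : ∀ q M → 4 * q + M + 4 * q ≡ 4 * (2 * q) + M
  double = solve-∀

module _ {k : ℕ} (a : ℕ → Fin k) where

  CentrallyEmbedded : ℕ → ℕ → Set
  CentrallyEmbedded x L =
    ∃[ z ] ∃[ t ] Palindrome (factor a (4 * z) (4 * t)) × EmbeddedCenter x L (4 * z) (4 * t)

  aligned-window : ∀ {x L} N r → x ≡ 4 * N + r → r < 4 → CentrallyEmbedded x L →
                   ∃[ u ] 2 * r + L ≡ 4 * u × Palindrome (factor a (4 * N) (4 * u))
  aligned-window {x} {L} N r x≡ r<4 (z , t , pal , emb)
    with d , x≡4z+d , 4t≡ ← EmbeddedCenter⇒margin emb
    with q , refl , refl ← offset-decomposition {z} {d} {N} {r} (trans (sym x≡4z+d) x≡) r<4 =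
    t ∸ 2 * q , window-quotient t q 4t≡window ,
    subst₂ (λ x′ y → Palindrome (factor a x′ y))
      (trans (+-comm (4 * q) (4 * z)) (sym (*-distribˡ-+ 4 z q))) (window-quotient t q 4t≡window)
      (palindrome-center a (4 * z) (4 * q) (2 * r + L) (subst (Palindrome ∘ factor a (4 * z)) 4t≡window pal))
    where
    4t≡window : 4 * t ≡ 4 * q + (2 * r + L) + 4 * q
    4t≡window = trans 4t≡ (margins q r L)
      where
      margins : ∀ q r L → 4 * q + r + L + (4 * q + r) ≡ 4 * q + (2 * r + L) + 4 * q
      margins = solve-∀

data Quadruples {A : Set} : List A → Set where
  []   : Quadruples []
  quad : ∀ x y {w} → Quadruples w → Quadruples (x ∷ y ∷ y ∷ x ∷ w)

Quadruples-++ : ∀ {A : Set} {u v : List A} → Quadruples u → Quadruples v → Quadruples (u ++ v)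
Quadruples-++ []            qv = qv
Quadruples-++ (quad x y qu) qv = quad x y (Quadruples-++ qu qv)

Quadruples-map : ∀ {A : Set} (g : A → A) {u : List A} → Quadruples u → Quadruples (map g u)
Quadruples-map g []            = []
Quadruples-map g (quad x y qu) = quad (g x) (g y) (Quadruples-map g qu)

module _ {k : ℕ} (c : Fin k) (f : ℕ → Permutation′ k) where

  wSeq-quadruples : ∀ m → Quadruples (wSeq c f (suc m))
  wSeq-quadruples zero    = quad c (f 0 ⟨$⟩ʳ c) []
  wSeq-quadruples (suc m) =
    Quadruples-++ q (Quadruples-++ q′ (Quadruples-++ q′ q))
    where
    q  = wSeq-quadruples m
    q′ = Quadruples-map (f (suc m) ⟨$⟩ʳ_) q

  <-length-wSeq : ∀ m → m < length (wSeq c f m)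
  <-length-wSeq zero    = s≤s z≤n
  <-length-wSeq (suc m) = begin-strict
    suc m                              <⟨ s≤s (<-length-wSeq m) ⟩
    1 + length w
      ≤⟨ +-monoˡ-≤ (length w) (≤-trans (s≤s z≤n) (<-length-wSeq m)) ⟩
    length w + length w
      ≤⟨ +-monoʳ-≤ (length w) (≤-trans (length-++-≤ʳ w {v}) (length-++-≤ʳ (v ++ w) {v})) ⟩
    length w + length (v ++ v ++ w)    ≡⟨ length-++ w ⟨
    length (wSeq c f (suc m))          ∎
    where
    open ≤-Reasoning
    w = wSeq c f m
    v = applyPerm (f m) w

module _ {k : ℕ} (a : ℕ → Fin k) where

  Quadruples⇒block-palindrome : ∀ {w} x → Quadruples w → factor a x (length w) ≡ w →
                                ∀ n → 4 * n + 4 ≤ length w → Palindrome (factor a (4 * n + x) 4)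
  Quadruples⇒block-palindrome x [] _ n 4n+4≤0 with () ← ≤-trans (m≤n+m 4 (4 * n)) 4n+4≤0
  Quadruples⇒block-palindrome {y₁ ∷ y₂ ∷ _ ∷ _ ∷ w} x (quad _ _ qw) prefix n 4n+4≤
    with block , rest ← ++-injective (factor a x 4) (y₁ ∷ y₂ ∷ y₂ ∷ y₁ ∷ [])
                          (length-factor a x 4) (trans (sym (factor-++ a x 4 (length w))) prefix)
    with n
  ... | zero  = subst Palindrome (sym block) refl
  ... | suc n = subst (λ y → Palindrome (factor a y 4)) (shift n x)
                  (Quadruples⇒block-palindrome (x + 4) qw rest n
                    (+-cancelˡ-≤ 4 _ _ (subst (_≤ 4 + length w) (shift′ n) 4n+4≤)))
    where
    shift : ∀ n x → 4 * n + (x + 4) ≡ 4 * suc n + x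
    shift = solve-∀
    shift′ : ∀ n → 4 * suc n + 4 ≡ 4 + (4 * n + 4)
    shift′ = solve-∀

  InC⇒block-palindrome : InC a → ∀ n → Palindrome (factor a (4 * n) 4)
  InC⇒block-palindrome (c , f , _ , prefix) n =
    subst (λ y → Palindrome (factor a y 4)) (+-identityʳ (4 * n))
      (Quadruples⇒block-palindrome 0 (wSeq-quadruples c f m) (prefix (suc m)) n
        (≤-trans (≤-reflexive (+-suc (4 * n) 3)) (<⇒≤ (<-length-wSeq c f (suc m)))))
    where m = 4 * n + 3

position-after : ∀ {b L b′} N r u → b ≡ 4 * N + r → 2 * r + L ≡ 4 * u → 4 * N + 4 * u ≡ b′ + r →
                 b + L ≡ b′
position-after {b} {L} {b′} N r u refl window end = +-cancelʳ-≡ r (4 * N + r + L) b′ (begin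
  4 * N + r + L + r       ≡⟨ rearrange (4 * N) r L ⟩
  4 * N + (2 * r + L)     ≡⟨ cong (4 * N +_) window ⟩
  4 * N + 4 * u           ≡⟨ end ⟩
  b′ + r                  ∎)
  where
  open ≡-Reasoning
  rearrange : ∀ x r L → x + r + L + r ≡ x + (2 * r + L)
  rearrange = solve-∀

m+n+1≡m+[1+n] : ∀ x m → x + m + 1 ≡ x + suc m
m+n+1≡m+[1+n] x m = trans (+-assoc x m 1) (cong (x +_) (+-comm m 1))

cost-step : ∀ {ℓ′ ℓ c′ c i} j → ℓ′ ≤ j + ℓ → j + c′ ≤ suc c → ℓ + c ≤ i → ℓ′ + c′ ≤ suc i
cost-step {ℓ′} {ℓ} {c′} {c} {i} j ℓ′≤ jc′≤ ℓc≤ = begin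
  ℓ′ + c′         ≤⟨ +-monoˡ-≤ c′ ℓ′≤ ⟩
  j + ℓ + c′      ≡⟨ cong (_+ c′) (+-comm j ℓ) ⟩
  ℓ + j + c′      ≡⟨ +-assoc ℓ j c′ ⟩
  ℓ + (j + c′)    ≤⟨ +-monoʳ-≤ ℓ jc′≤ ⟩
  ℓ + suc c       ≡⟨ +-suc ℓ c ⟩
  suc (ℓ + c)     ≤⟨ s≤s ℓc≤ ⟩
  suc i           ∎
  where open ≤-Reasoning

[m+4n]%4≡m%4 : ∀ m n → (m + 4 * n) % 4 ≡ m % 4
[m+4n]%4≡m%4 m n = trans (cong (λ x → (m + x) % 4) (*-comm 4 n)) ([m+kn]%n≡m%n m n 4)

[4n+m]%4≡m%4 : ∀ n m → (4 * n + m) % 4 ≡ m % 4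
[4n+m]%4≡m%4 n m = trans (cong (_% 4) (+-comm (4 * n) m)) ([m+4n]%4≡m%4 m n)

m+n≡o⇒m≡o∸n : ∀ {m n o} → m + n ≡ o → m ≡ o ∸ n
m+n≡o⇒m≡o∸n {m} {n} refl = sym (m+n∸n≡m m n)

module NormalForm {k : ℕ} (a : ℕ → Fin k) (block-palindrome : ∀ n → Palindrome (factor a (4 * n) 4))
  where

  Word = List (Fin k)

  Block : Word → Set
  Block q = Palindrome q × PosMult4 q

  record BlockDecomposition (n : ℕ) (qs : List Word) : Set where
    constructor blockDecomposition
    field
      concat≡ : concat qs ≡ factor a 0 (4 * n)
      blocks  : All Block qs

  close-window : ∀ n {qs} m → BlockDecomposition n qs → Palindrome (factor a (4 * n) (4 * m)) →
                 ∃[ qs′ ] BlockDecomposition (n + m) qs′ × length qs′ ≤ 1 + length qs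
  close-window n {qs} zero    bd _   =
    qs , subst (λ n′ → BlockDecomposition n′ qs) (sym (+-identityʳ n)) bd , n≤1+n (length qs)
  close-window n {qs} (suc e) (blockDecomposition concat≡ blocks) pal =
    qs ++ q ∷ [] ,
    blockDecomposition concat≡′ (++⁺ blocks ((pal , e , length-factor a (4 * n) (4 * suc e)) ∷ [])) ,
    ≤-reflexive (trans (length-++ qs) (+-comm (length qs) 1))
    where
    open ≡-Reasoning
    q = factor a (4 * n) (4 * suc e)
    concat≡′ : concat (qs ++ q ∷ []) ≡ factor a 0 (4 * (n + suc e))
    concat≡′ = begin
      concat (qs ++ q ∷ [])                    ≡⟨ concat-++ qs (q ∷ []) ⟨
      concat qs ++ q ++ []                     ≡⟨ cong₂ _++_ concat≡ (++-identityʳ q) ⟩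
      factor a 0 (4 * n) ++ q                  ≡⟨ factor-++ a 0 (4 * n) (4 * suc e) ⟨
      factor a 0 (4 * n + 4 * suc e)           ≡⟨ cong (factor a 0) (*-distribˡ-+ 4 n (suc e)) ⟨
      factor a 0 (4 * (n + suc e))             ∎

  strip-block : ∀ N m → Palindrome (factor a (4 * N) (4 * (2 + m))) →
                Palindrome (factor a (4 * suc N) (4 * m))
  strip-block N m pal = subst (λ x → Palindrome (factor a x (4 * m))) (sym (*-suc 4 N))
    (palindrome-center a (4 * N) 4 (4 * m) (subst (Palindrome ∘ factor a (4 * N)) (widen m) pal))
    where
    widen : ∀ m → 4 * (2 + m) ≡ 4 + 4 * m + 4
    widen = solve-∀

  close-overlapping : ∀ n {qs} w m → BlockDecomposition n qs →
                      Palindrome (factor a (4 * n) (4 * suc w)) →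
                      Palindrome (factor a (4 * (n + w)) (4 * (2 + m))) →
                      ∃[ qs′ ] BlockDecomposition (n + suc w + m) qs′ × length qs′ ≤ 2 + length qs
  close-overlapping n w m bd W P
    with qs₁ , bd₁ , len₁ ← close-window n (suc w) bd W
    with qs₂ , bd₂ , len₂ ← close-window (n + suc w) m bd₁
           (subst (λ x → Palindrome (factor a (4 * x) (4 * m))) (sym (+-suc n w)) (strip-block (n + w) m P))
    = qs₂ , bd₂ , ≤-trans len₂ (s≤s len₁)

  -- The last two tails keep the aligned palindromic window w_a(4n, 4e+4), resp.
  -- w_a(4n, 4e+8), whose centre l is; a later factor that runs past l closes the
  -- window into a block.
  data Tail (n : ℕ) : ℕ → ℕ → Set where
    none               : Tail n 0 0
    letter             : Tail n 1 1
    letter-letter      : Tail n 2 2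
    letter-even        : ∀ e → Palindrome (factor a (4 * n) (4 * suc e)) → Tail n (1 + (2 + 4 * e)) 2
    letter-letter-even : ∀ e → Palindrome (factor a (4 * n) (4 * (2 + e))) → Tail n (2 + (4 + 4 * e)) 3

  pieces : ∀ {n m c} → Tail n m c → List Word
  pieces {n} none                     = []
  pieces {n} letter                   = (a (4 * n) ∷ []) ∷ []
  pieces {n} letter-letter            = (a (4 * n) ∷ []) ∷ (a (1 + 4 * n) ∷ []) ∷ []
  pieces {n} (letter-even e _)        = (a (4 * n) ∷ []) ∷ factor a (1 + 4 * n) (2 + 4 * e) ∷ []
  pieces {n} (letter-letter-even e _) =
    (a (4 * n) ∷ []) ∷ (a (1 + 4 * n) ∷ []) ∷ factor a (2 + 4 * n) (4 + 4 * e) ∷ []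

  length-pieces : ∀ {n m c} (t : Tail n m c) → length (pieces t) ≡ c
  length-pieces none                     = refl
  length-pieces letter                   = refl
  length-pieces letter-letter            = refl
  length-pieces (letter-even _ _)        = refl
  length-pieces (letter-letter-even _ _) = refl

  concat-pieces : ∀ {n m c} (t : Tail n m c) → concat (pieces t) ≡ factor a (4 * n) m
  concat-pieces {n} none = refl
  concat-pieces {n} letter = sym (factor-suc a (4 * n) 0)
  concat-pieces {n} letter-letter =
    sym (trans (factor-suc a (4 * n) 1) (cong (a (4 * n) ∷_) (factor-suc a (1 + 4 * n) 0)))
  concat-pieces {n} (letter-even e _) =
    trans (cong (a (4 * n) ∷_) (++-identityʳ _)) (sym (factor-suc a (4 * n) (2 + 4 * e)))
  concat-pieces {n} (letter-letter-even e _) =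
    trans (cong (λ l → a (4 * n) ∷ a (1 + 4 * n) ∷ l) (++-identityʳ _))
      (sym (trans (factor-suc a (4 * n) (5 + 4 * e))
                  (cong (a (4 * n) ∷_) (factor-suc a (1 + 4 * n) (4 + 4 * e)))))

  pieces-palindromic : ∀ {n m c} (t : Tail n m c) → All (λ p → Palindrome p × p ≢ []) (pieces t)
  pieces-palindromic none = []
  pieces-palindromic letter = (refl , λ ()) ∷ []
  pieces-palindromic letter-letter = (refl , λ ()) ∷ (refl , λ ()) ∷ []
  pieces-palindromic {n} (letter-even e W) =
    (refl , λ ()) ∷
    (palindrome-center a (4 * n) 1 (2 + 4 * e) (subst (Palindrome ∘ factor a (4 * n)) (widen e) W) , λ ()) ∷ []
    where
    widen : ∀ e → 4 * suc e ≡ 1 + (2 + 4 * e) + 1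
    widen = solve-∀
  pieces-palindromic {n} (letter-letter-even e W) =
    (refl , λ ()) ∷ (refl , λ ()) ∷
    (palindrome-center a (4 * n) 2 (4 + 4 * e) (subst (Palindrome ∘ factor a (4 * n)) (widen e) W) , λ ()) ∷ []
    where
    widen : ∀ e → 4 * (2 + e) ≡ 2 + (4 + 4 * e) + 2
    widen = solve-∀

  data Normal (b i : ℕ) : Set where
    normal : ∀ {n m c} qs → BlockDecomposition n qs → Tail n m c →
             b ≡ 4 * n + m → length qs + c ≤ i → Normal b i

  normal-letter : ∀ {b i} → Normal b i → Normal (b + 1) (suc i)
  normal-letter (normal {n} qs bd none refl cost) =
    normal qs bd letter (m+n+1≡m+[1+n] (4 * n) 0) (cost-step 0 ≤-refl ≤-refl cost)
  normal-letter (normal {n} qs bd letter refl cost) =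
    normal qs bd letter-letter (m+n+1≡m+[1+n] (4 * n) 1) (cost-step 0 ≤-refl ≤-refl cost)
  normal-letter (normal {n} qs bd letter-letter refl cost) =
    normal qs bd (letter-even 0 (block-palindrome n)) (m+n+1≡m+[1+n] (4 * n) 2)
           (cost-step 0 ≤-refl (n≤1+n 2) cost)
  normal-letter (normal {n} qs bd (letter-even e W) refl cost)
    with qs′ , bd′ , len ← close-window n (suc e) bd W =
    normal qs′ bd′ none (position n e) (cost-step 1 len (s≤s z≤n) cost)
    where
    position : ∀ n e → 4 * n + (1 + (2 + 4 * e)) + 1 ≡ 4 * (n + suc e) + 0
    position = solve-∀
  normal-letter (normal {n} qs bd (letter-letter-even e W) refl cost) =
    normal qs bd (letter-even (suc e) W) (position n e) (cost-step 0 ≤-refl (s≤s (s≤s z≤n)) cost)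
    where
    position : ∀ n e → 4 * n + (2 + (4 + 4 * e)) + 1 ≡ 4 * n + (1 + (2 + 4 * suc e))
    position = solve-∀

  letter-even-start : ∀ n e → 4 * n + (1 + (2 + 4 * e)) ≡ 4 * (n + e) + 3
  letter-even-start = solve-∀

  letter-letter-even-start : ∀ n e → 4 * n + (2 + (4 + 4 * e)) ≡ 4 * (n + suc e) + 2
  letter-letter-even-start = solve-∀

  -- The clauses for windows too short to contain the factor are absurd by the
  -- equation 2 * r + (2 + L) ≡ 4 * u and are omitted.
  normal-piece : ∀ {b i} L → CentrallyEmbedded a b (2 + L) → Normal b i → Normal (b + (2 + L)) (suc i)
  normal-piece L emb (normal {n} qs bd none refl cost) with aligned-window a n 0 refl (s≤s z≤n) emb
  ... | suc e , window , P with qs′ , bd′ , len ← close-window n (suc e) bd P =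
    normal qs′ bd′ none (position-after n 0 (suc e) refl window (end n e)) (cost-step 1 len ≤-refl cost)
    where
    end : ∀ n e → 4 * n + 4 * suc e ≡ 4 * (n + suc e) + 0 + 0
    end = solve-∀
  normal-piece L emb (normal {n} qs bd letter refl cost) with aligned-window a n 1 refl (s≤s (s≤s z≤n)) emb
  ... | suc e , window , P =
    normal qs bd (letter-even e P) (position-after n 1 (suc e) refl window (end n e))
           (cost-step 0 ≤-refl ≤-refl cost)
    where
    end : ∀ n e → 4 * n + 4 * suc e ≡ 4 * n + (1 + (2 + 4 * e)) + 1
    end = solve-∀
  normal-piece L emb (normal {n} qs bd letter-letter refl cost)
    with aligned-window a n 2 refl (s≤s (s≤s (s≤s z≤n))) emb
  ... | suc (suc e) , window , P =
    normal qs bd (letter-letter-even e P) (position-after n 2 (2 + e) refl window (end n e))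
           (cost-step 0 ≤-refl ≤-refl cost)
    where
    end : ∀ n e → 4 * n + 4 * (2 + e) ≡ 4 * n + (2 + (4 + 4 * e)) + 2
    end = solve-∀
  normal-piece L emb (normal {n} qs bd (letter-even e W) refl cost)
    with aligned-window a (n + e) 3 (letter-even-start n e) ≤-refl emb
  ... | suc (suc m) , window , P with qs′ , bd′ , len ← close-overlapping n e m bd W P =
    normal qs′ bd′ letter (position-after (n + e) 3 (2 + m) (letter-even-start n e) window (end n e m))
           (cost-step 2 len ≤-refl cost)
    where
    end : ∀ n e m → 4 * (n + e) + 4 * (2 + m) ≡ 4 * (n + suc e + m) + 1 + 3
    end = solve-∀
  normal-piece L emb (normal {n} qs bd (letter-letter-even e W) refl cost)
    with aligned-window a (n + suc e) 2 (letter-letter-even-start n e) (s≤s (s≤s (s≤s z≤n))) emb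
  ... | suc (suc m) , window , P with qs′ , bd′ , len ← close-overlapping n (suc e) m bd W P =
    normal qs′ bd′ letter-letter
           (position-after (n + suc e) 2 (2 + m) (letter-letter-even-start n e) window (end n e m))
           (cost-step 2 len ≤-refl cost)
    where
    end : ∀ n e m → 4 * (n + suc e) + 4 * (2 + m) ≡ 4 * (n + suc (suc e) + m) + 2 + 2
    end = solve-∀

  normal-step : ∀ {b i} L → suc L ≡ 1 ⊎ CentrallyEmbedded a b (suc L) →
                Normal b i → Normal (b + suc L) (suc i)
  normal-step zero    _          = normal-letter
  normal-step (suc L) (inj₁ ())
  normal-step (suc L) (inj₂ emb) = normal-piece L emb

  normal-prefix : ∀ ps {b i} → All (_≢ []) ps → All (GoodOccurrence a) (occurrences b ps) →
                  Normal b i → Normal (b + length (concat ps)) (i + length ps)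
  normal-prefix [] {b} {i} [] [] nb = subst₂ Normal (sym (+-identityʳ b)) (sym (+-identityʳ i)) nb
  normal-prefix ([] ∷ _) (nonempty ∷ _) _ = ⊥-elim (nonempty refl)
  normal-prefix ((x ∷ p) ∷ ps) {b} {i} (_ ∷ nonempty) (good ∷ goods) nb =
    subst₂ Normal length≡ (sym (+-suc i (length ps)))
      (normal-prefix ps nonempty goods (normal-step (length p) good nb))
    where
    length≡ : b + suc (length p) + length (concat ps) ≡ b + length ((x ∷ p) ++ concat ps)
    length≡ = trans (+-assoc b _ _) (cong (b +_) (sym (length-++ (x ∷ p))))

  even-length : ∀ x ℓ h → ℓ ≡ 2 * h → EvenLen (factor a x ℓ)
  even-length x ℓ h ℓ≡ = h , trans (length-factor a x ℓ) ℓ≡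

  tail-forms : ∀ {n m c r qs} (t : Tail n m c) → All PosMult4 qs → length qs + c ≡ r →
               Forms r (4 * n + m) (qs ++ pieces t)
  tail-forms {n} {qs = qs} none mult4 size =
    inj₁ (qs , ++-identityʳ qs , mult4 , m+n≡o⇒m≡o∸n size , [4n+m]%4≡m%4 n 0)
  tail-forms {n} {qs = qs} letter mult4 size =
    inj₂ (inj₁ (qs , _ , refl , mult4 , m+n≡o⇒m≡o∸n size , refl , [4n+m]%4≡m%4 n 1))
  tail-forms {n} {qs = qs} letter-letter mult4 size =
    inj₂ (inj₂ (inj₁ (qs , _ , _ , refl , mult4 , m+n≡o⇒m≡o∸n size , refl , refl ,
      [4n+m]%4≡m%4 n 2)))
  tail-forms {n} {qs = qs} (letter-even e _) mult4 size =
    inj₂ (inj₂ (inj₂ (inj₁ (qs , _ , _ , refl , mult4 , m+n≡o⇒m≡o∸n size , refl ,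
      even-length (1 + 4 * n) (2 + 4 * e) (1 + 2 * e) (halve e) ,
      trans ([4n+m]%4≡m%4 n (3 + 4 * e)) ([m+4n]%4≡m%4 3 e)))))
    where
    halve : ∀ e → 2 + 4 * e ≡ 2 * (1 + 2 * e)
    halve = solve-∀
  tail-forms {n} {qs = qs} (letter-letter-even e _) mult4 size =
    inj₂ (inj₂ (inj₂ (inj₂ (qs , _ , _ , _ , refl , mult4 , m+n≡o⇒m≡o∸n size , refl , refl ,
      even-length (2 + 4 * n) (4 + 4 * e) (2 + 2 * e) (halve e) ,
      trans ([4n+m]%4≡m%4 n (6 + 4 * e)) ([m+4n]%4≡m%4 6 e)))))
    where
    halve : ∀ e → 4 + 4 * e ≡ 2 * (2 + 2 * e)
    halve = solve-∀

  Block⇒nonempty-palindrome : ∀ {q} → Block q → Palindrome q × q ≢ []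
  Block⇒nonempty-palindrome (pal , m , length≡) = pal , λ { refl → 0≢1+n length≡ }

  normal⇒optimal-form : ∀ {s r} → Normal s r →
                        (∀ qs → IsPalDecomp (factor a 0 s) qs → r ≤ length qs) →
                        ∃[ ds ] IsOptimalPalDecomp (factor a 0 s) ds × Forms r s ds
  normal⇒optimal-form {r = r} (normal {n} {m} {c} qs (blockDecomposition concat≡ blocks) t refl cost) r≤ =
    qs ++ pieces t , (decomposition , λ qs′ d → subst (_≤ length qs′) (sym length≡r) (r≤ qs′ d)) ,
    tail-forms t (All.map proj₂ blocks) size
    where
    open ≡-Reasoning
    decomposition : IsPalDecomp (factor a 0 (4 * n + m)) (qs ++ pieces t)
    decomposition = (begin
        concat (qs ++ pieces t)              ≡⟨ concat-++ qs (pieces t) ⟨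
        concat qs ++ concat (pieces t)       ≡⟨ cong₂ _++_ concat≡ (concat-pieces t) ⟩
        factor a 0 (4 * n) ++ factor a (4 * n) m ≡⟨ factor-++ a 0 (4 * n) m ⟨
        factor a 0 (4 * n + m)               ∎)
      , ++⁺ (All.map Block⇒nonempty-palindrome blocks) (pieces-palindromic t)
    length≡ : length (qs ++ pieces t) ≡ length qs + c
    length≡ = trans (length-++ qs) (cong (length qs +_) (length-pieces t))
    size : length qs + c ≡ r
    size = ≤-antisym cost (subst (r ≤_) length≡ (r≤ _ decomposition))
    length≡r : length (qs ++ pieces t) ≡ r
    length≡r = trans length≡ size

lemma4 : (k : ℕ) → 2 ≤ k → (a : ℕ → Fin k) → InC a → (s : ℕ) → 1 ≤ s →
         (ps : List (List (Fin k))) → IsOptimalPalDecomp (factor a 0 s) ps →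
         All (GoodOccurrence a) (occurrences 0 ps) →
         ∃[ ds ] IsOptimalPalDecomp (factor a 0 s) ds × Forms (length ps) s ds
lemma4 k _ a inC s _ ps ((concat≡ , palindromes) , optimal) goods =
  normal⇒optimal-form (subst (λ b → Normal b (length ps)) length≡s scanned) optimal
  where
  open NormalForm a (InC⇒block-palindrome a inC)
  scanned : Normal (length (concat ps)) (length ps)
  scanned = normal-prefix ps (All.map proj₂ palindromes) goods
              (normal {n = 0} [] (blockDecomposition refl []) none refl z≤n)
  length≡s : length (concat ps) ≡ s
  length≡s = trans (cong length concat≡) (length-factor a 0 s)
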